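{- For any graph $G$ and every $n\ge 3$, $q(n,G)=h(n,G)$.
   Context: Let $E_n=E(K_n)$. For $0\le m\le\binom n2$, let $F_{n,m,1}$ be the set of maps $f:E_n\to E_n$ such that $|f(e)\cap e|\le 1$ (i.e. $f(e)\ne e$) for at least $m$ edges $e\in E_n$. A subgraph $G'$ of a graph is $f$-free if $f(e)\notin E(G')$ for all $e\in E(G')$. $q(n,G)$ is the maximum $m$ such that some $f\in F_{n,m,1}$ exists with no $f$-free copy of $G$ in $K_n$. For a graph $H$, $F_{H,1}$ is the set of maps $f:E(H)\to E(H)$ with $f(e)\ne e$ for all $e$. $h(n,G)$ is the maximum number of edges of an $n$-vertex graph $H$ for which some $f\in F_{H,1}$ exists with no $f$-free copy of $G$ in $H$. -}

module Defs where

open import Data.Nat using (ℕ; _≤_)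
open import Data.Nat.Combinatorics using (_C_)
open import Data.Fin using (Fin; _<_)
open import Data.Bool using (Bool; true; T)
open import Data.Product using (Σ; ∃; _×_; proj₁; proj₂)
open import Data.Sum using (_⊎_)
open import Data.List using (List; length)
open import Data.List.Relation.Unary.All using (All)
open import Data.List.Relation.Unary.Unique.Propositional using (Unique)
open import Data.List.Membership.Propositional using (_∈_)
open import Relation.Nullary using (¬_)
open import Relation.Binary.PropositionalEquality using (_≡_; _≢_)
open import Function.Definitions using (Injective)
open import Function.Bundles using (_⇔_)

-- Edges of K_n on vertex set Fin n: unordered pairs {a,b}, stored as (a , b) with a < b.
Edge : ℕ → Set
Edge n = Σ (Fin n × Fin n) (λ p → proj₁ p < proj₂ p)

Graph : ℕ → Set
Graph n = Edge n → Bool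

K : (n : ℕ) → Graph n
K n e = true

E : {n : ℕ} → Graph n → Set
E {n} H = Σ (Edge n) (λ e → T (H e))

NumEdges : {n : ℕ} → Graph n → ℕ → Set
NumEdges {n} H m =
  Σ (List (Edge n)) (λ L → Unique L × length L ≡ m × ((e : Edge n) → (T (H e) ⇔ (e ∈ L))))

SameEnds : {k n : ℕ} → (Fin k → Fin n) → Edge k → Edge n → Set
SameEnds φ d e =
  ((φ (proj₁ (proj₁ d)) ≡ proj₁ (proj₁ e)) × (φ (proj₂ (proj₁ d)) ≡ proj₂ (proj₁ e)))
  ⊎ ((φ (proj₁ (proj₁ d)) ≡ proj₂ (proj₁ e)) × (φ (proj₂ (proj₁ d)) ≡ proj₁ (proj₁ e)))

InCopy : {k n : ℕ} → Graph k → (Fin k → Fin n) → Edge n → Set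
InCopy G φ e = ∃ (λ d → T (G d) × SameEnds φ d e)

IsCopy : {k n : ℕ} → Graph k → Graph n → (Fin k → Fin n) → Set
IsCopy G H φ = Injective _≡_ _≡_ φ × ((e : _) → InCopy G φ e → T (H e))

HasFreeCopyKn : {k : ℕ} (n : ℕ) → Graph k → (Edge n → Edge n) → Set
HasFreeCopyKn {k} n G f =
  Σ (Fin k → Fin n) (λ φ → IsCopy G (K n) φ ×
     ((e : Edge n) → InCopy G φ e → ¬ InCopy G φ (f e)))

HasFreeCopy : {k n : ℕ} → Graph k → (H : Graph n) → (E H → E H) → Set
HasFreeCopy {k} {n} G H f =
  Σ (Fin k → Fin n) (λ φ → IsCopy G H φ ×
     ((e : E H) → InCopy G φ (proj₁ e) → ¬ InCopy G φ (proj₁ (f e))))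

-- f ∈ F_{n,m,1}: f(e) ≠ e for at least m edges e ∈ E_n.
InF : (n m : ℕ) → (Edge n → Edge n) → Set
InF n m f = Σ (List (Edge n)) (λ L → Unique L × length L ≡ m × All (λ e → f e ≢ e) L)

InFH : {n : ℕ} (H : Graph n) → (E H → E H) → Set
InFH H f = (e : E H) → f e ≢ e

QPred : {k : ℕ} → ℕ → Graph k → ℕ → Set
QPred n G m = m ≤ n C 2 × Σ (Edge n → Edge n) (λ f → InF n m f × ¬ HasFreeCopyKn n G f)

HPred : {k : ℕ} → ℕ → Graph k → ℕ → Set
HPred {k} n G m =
  Σ (Graph n) (λ H → NumEdges H m × Σ (E H → E H) (λ f → InFH H f × ¬ HasFreeCopy G H f))

IsMax : (ℕ → Set) → ℕ → Set
IsMax P x = P x × ((m : ℕ) → P m → m ≤ x)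

-- Given H with a derangement f_H of E(H), extend f_H by the identity to E(K_n): an f-free copy
-- of G in K_n cannot use a fixed edge, so it lies in H and is f_H-free.  Conversely, given
-- f : E_n → E_n, let H be the set S of edges moved by f and redirect each f(e) ∉ S to another
-- edge of S; a free copy of G in H is then f-free in K_n, because an edge f(e) ∉ H lies outside
-- every copy in H.  This needs |S| ≥ 2.  If S = {e₀}, take H = {e₀, f(e₀)} with the swap: a
-- free copy in H has its edges in {e₀} or in {f(e₀)}, and a relabelling of the vertices moves
-- the latter onto e₀, giving an f-free copy in K_n.  So each q-witness with m moved edges
-- yields an h-witness with at least m edges and vice versa, hence the maxima coincide.
module Submission where

open import Defs
open import Data.Nat using (ℕ; zero; suc; _+_; _≤_; z≤n; s≤s)
open import Data.Nat.Properties using (≤-antisym; ≤-trans; ≤-refl; ≤-reflexive; <-irrelevant; <-asym)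
open import Data.Nat.Combinatorics using (_C_; nC1≡n; nCk+nC[k+1]≡[n+1]C[k+1])
open import Data.Fin using (Fin; zero; suc)
open import Data.Fin.Properties using (_≟_; <⇒≢; <-cmp)
open import Data.Fin.Permutation.Components using (transpose; transpose-inverse)
open import Data.Bool using (T)
open import Data.Bool.Properties using (T?; T-irrelevant)
open import Data.Unit using (tt)
open import Data.Empty using (⊥; ⊥-elim)
open import Data.Product using (Σ; ∃; _×_; _,_; proj₁; proj₂)
open import Data.Product.Properties using (≡-dec)
open import Data.Sum using (_⊎_; inj₁; inj₂)
open import Data.List using (List; []; _∷_; length; map; _++_; filter; allFin)
open import Data.List.Properties using (length-map; length-++; length-tabulate; length-removeAt′)
open import Data.List.Relation.Unary.All as All using (All; _∷_)
open import Data.List.Relation.Unary.Any using (here; there; any?; _─_; index)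
open import Data.List.Relation.Unary.Unique.Propositional using (Unique; []; _∷_)
open import Data.List.Relation.Unary.Unique.Propositional.Properties using (map⁺; ++⁺; allFin⁺; filter⁺)
open import Data.List.Membership.Propositional using (_∈_)
open import Data.List.Membership.Propositional.Properties
  using (∈-map⁺; ∈-map⁻; ∈-++⁺ˡ; ∈-++⁺ʳ; ∈-allFin; ∈-filter⁺; ∈-filter⁻)
open import Relation.Nullary using (¬_; yes; no)
open import Relation.Unary using (Decidable)
open import Relation.Nullary.Decidable using (isYes; toWitness; fromWitness; ¬?)
open import Relation.Binary using (DecidableEquality; tri<; tri≈; tri>)
open import Relation.Binary.PropositionalEquality
open import Function using (_∘_)
open import Function.Definitions using (Injective)
open import Function.Bundles using (_⇔_; mk⇔; Equivalence)

low high : ∀ {n} → Edge n → Fin n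
low e = proj₁ (proj₁ e)
high e = proj₂ (proj₁ e)

edge-≡ : ∀ {n} {e e′ : Edge n} → proj₁ e ≡ proj₁ e′ → e ≡ e′
edge-≡ {e = ends , _} refl = cong (ends ,_) (<-irrelevant _ _)

_≟ₑ_ : ∀ {n} → DecidableEquality (Edge n)
_≟ₑ_ = ≡-dec (≡-dec _≟_ _≟_) (λ p q → yes (<-irrelevant p q))

E-≡ : ∀ {n} {H : Graph n} {x y : E H} → proj₁ x ≡ proj₁ y → x ≡ y
E-≡ {x = e , t} {.e , t′} refl = cong (e ,_) (T-irrelevant t t′)

ends-not-swapped : ∀ {n} {e e′ : Edge n} → low e ≡ high e′ → high e ≡ low e′ → ⊥
ends-not-swapped {e = _ , l<h} {_ , l′<h′} refl refl = <-asym l<h l′<h′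

edgeFromZero : ∀ {n} → Fin n → Edge (suc n)
edgeFromZero b = (zero , suc b) , s≤s z≤n

liftEdge : ∀ {n} → Edge n → Edge (suc n)
liftEdge ((a , b) , a<b) = (suc a , suc b) , s≤s a<b

allEdges : (n : ℕ) → List (Edge n)
allEdges zero = []
allEdges (suc n) = map edgeFromZero (allFin n) ++ map liftEdge (allEdges n)

∈-allEdges : ∀ {n} (e : Edge n) → e ∈ allEdges n
∈-allEdges {suc n} ((zero , suc b) , s≤s z≤n) = ∈-++⁺ˡ (∈-map⁺ edgeFromZero (∈-allFin b))
∈-allEdges {suc n} ((suc a , suc b) , s≤s a<b) =
  ∈-++⁺ʳ (map edgeFromZero (allFin n)) (∈-map⁺ liftEdge (∈-allEdges ((a , b) , a<b)))

allEdges-unique : ∀ n → Unique (allEdges n)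
allEdges-unique zero = []
allEdges-unique (suc n) =
  ++⁺ (map⁺ (λ { refl → refl }) (allFin⁺ n)) (map⁺ liftEdge-injective (allEdges-unique n)) disjoint
  where
  liftEdge-injective : ∀ {e e′ : Edge n} → liftEdge e ≡ liftEdge e′ → e ≡ e′
  liftEdge-injective {e = (a , b) , _} {(.a , .b) , _} refl = refl
  disjoint : ∀ {e} → ¬ (e ∈ map edgeFromZero (allFin n) × e ∈ map liftEdge (allEdges n))
  disjoint (fromZero , lifted) with ∈-map⁻ edgeFromZero fromZero | ∈-map⁻ liftEdge lifted
  ... | _ , _ , refl | _ , _ , ()

length-allEdges : ∀ n → length (allEdges n) ≡ n C 2
length-allEdges zero = refl
length-allEdges (suc n) = begin
  length (map edgeFromZero (allFin n) ++ map liftEdge (allEdges n))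
    ≡⟨ length-++ (map edgeFromZero (allFin n)) ⟩
  length (map edgeFromZero (allFin n)) + length (map liftEdge (allEdges n))
    ≡⟨ cong₂ _+_ (trans (length-map edgeFromZero (allFin n)) (length-tabulate (λ i → i)))
                 (trans (length-map liftEdge (allEdges n)) (length-allEdges n)) ⟩
  n + n C 2
    ≡⟨ cong (_+ n C 2) (sym (nC1≡n n)) ⟩
  n C 1 + n C 2
    ≡⟨ nCk+nC[k+1]≡[n+1]C[k+1] n 1 ⟩
  suc n C 2 ∎
  where open ≡-Reasoning

module _ {A : Set} where

  ∈-─ : ∀ {x z : A} {ys} (x∈ys : x ∈ ys) → z ∈ ys → x ≢ z → z ∈ (ys ─ x∈ys)
  ∈-─ (here refl) (here refl) x≢z = ⊥-elim (x≢z refl)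
  ∈-─ (here _)    (there z∈ys) _ = z∈ys
  ∈-─ (there _)   (here refl)  _ = here refl
  ∈-─ (there x∈ys) (there z∈ys) x≢z = there (∈-─ x∈ys z∈ys x≢z)

  unique⇒length-≤ : ∀ {xs ys : List A} → Unique xs → (∀ {z} → z ∈ xs → z ∈ ys) → length xs ≤ length ys
  unique⇒length-≤ {[]} _ _ = z≤n
  unique⇒length-≤ {x ∷ xs} {ys} (x∉xs ∷ unique) xs⊆ys =
    subst (suc (length xs) ≤_) (sym (length-removeAt′ ys (index x∈ys)))
      (s≤s (unique⇒length-≤ unique (λ z∈xs → ∈-─ x∈ys (xs⊆ys (there z∈xs)) (All.lookup x∉xs z∈xs))))
    where
    x∈ys = xs⊆ys (here refl)

unique⇒length-≤-C2 : ∀ {n} {L : List (Edge n)} → Unique L → length L ≤ n C 2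
unique⇒length-≤-C2 {n} unique =
  ≤-trans (unique⇒length-≤ unique (λ {e} _ → ∈-allEdges e)) (≤-reflexive (length-allEdges n))

module _ {n : ℕ} (i j : Fin n) where

  transpose-applyˡ : transpose i j i ≡ j
  transpose-applyˡ with i ≟ i
  ... | yes _ = refl
  ... | no i≢i = ⊥-elim (i≢i refl)

  transpose-fixes : ∀ {k} → k ≢ i → k ≢ j → transpose i j k ≡ k
  transpose-fixes {k} k≢i k≢j with k ≟ i
  ... | yes k≡i = ⊥-elim (k≢i k≡i)
  ... | no _ with k ≟ j
  ...   | yes k≡j = ⊥-elim (k≢j k≡j)
  ...   | no _ = refl

  transpose-injective : Injective _≡_ _≡_ (transpose i j)
  transpose-injective eq =
    trans (sym (transpose-inverse j i)) (trans (cong (transpose j i) eq) (transpose-inverse j i))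

relabelling : ∀ {n} (e₁ e₀ : Edge n) → Σ (Fin n → Fin n) λ σ →
  Injective _≡_ _≡_ σ × σ (low e₁) ≡ low e₀ × σ (high e₁) ≡ high e₀
relabelling ((l₁ , h₁) , l₁<h₁) ((l₀ , h₀) , l₀<h₀) =
  σ , transpose-injective l₁ l₀ ∘ transpose-injective c h₀ , σ-l₁ , transpose-applyˡ c h₀
  where
  c = transpose l₁ l₀ h₁
  σ = transpose c h₀ ∘ transpose l₁ l₀
  l₀≢c : l₀ ≢ c
  l₀≢c eq = <⇒≢ l₁<h₁ (transpose-injective l₁ l₀ (trans (transpose-applyˡ l₁ l₀) eq))
  σ-l₁ : σ l₁ ≡ l₀
  σ-l₁ = begin
    transpose c h₀ (transpose l₁ l₀ l₁) ≡⟨ cong (transpose c h₀) (transpose-applyˡ l₁ l₀) ⟩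
    transpose c h₀ l₀                   ≡⟨ transpose-fixes c h₀ l₀≢c (<⇒≢ l₀<h₀) ⟩
    l₀                                  ∎
    where open ≡-Reasoning

module _ {k n : ℕ} (φ : Fin k → Fin n) (d : Edge k) where

  SameEnds-functional : ∀ {e e′} → SameEnds φ d e → SameEnds φ d e′ → e ≡ e′
  SameEnds-functional (inj₁ (a , b)) (inj₁ (a′ , b′)) =
    edge-≡ (cong₂ _,_ (trans (sym a) a′) (trans (sym b) b′))
  SameEnds-functional {e} {e′} (inj₁ (a , b)) (inj₂ (a′ , b′)) =
    ⊥-elim (ends-not-swapped {e = e} {e′} (trans (sym a) a′) (trans (sym b) b′))
  SameEnds-functional {e} {e′} (inj₂ (a , b)) (inj₁ (a′ , b′)) =
    ⊥-elim (ends-not-swapped {e = e} {e′} (trans (sym b) b′) (trans (sym a) a′))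
  SameEnds-functional (inj₂ (a , b)) (inj₂ (a′ , b′)) =
    edge-≡ (cong₂ _,_ (trans (sym b) b′) (trans (sym a) a′))

  SameEnds-∘ : ∀ (σ : Fin n → Fin n) {e e′} → σ (low e) ≡ low e′ → σ (high e) ≡ high e′ →
    SameEnds φ d e → SameEnds (σ ∘ φ) d e′
  SameEnds-∘ σ σl σh (inj₁ (a , b)) = inj₁ (trans (cong σ a) σl , trans (cong σ b) σh)
  SameEnds-∘ σ σl σh (inj₂ (a , b)) = inj₂ (trans (cong σ a) σh , trans (cong σ b) σl)

  imageEdge : Injective _≡_ _≡_ φ → ∃ (SameEnds φ d)
  imageEdge injective with <-cmp (φ (low d)) (φ (high d))
  ... | tri< l<h _ _ = ((φ (low d) , φ (high d)) , l<h) , inj₁ (refl , refl)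
  ... | tri≈ _ l≡h _ = ⊥-elim (<⇒≢ (proj₂ d) (injective l≡h))
  ... | tri> _ _ h<l = ((φ (high d) , φ (low d)) , h<l) , inj₂ (refl , refl)

module _ {k n : ℕ} {G : Graph k} where

  isCopy-Kn : ∀ {H : Graph n} {φ} → IsCopy G H φ → IsCopy G (K n) φ
  isCopy-Kn (injective , _) = injective , λ _ _ → tt

  moveSingleEdgeCopy : ∀ {φ e₁} (e₀ : Edge n) →
    Injective _≡_ _≡_ φ → (∀ e → InCopy G φ e → e ≡ e₁) →
    Σ (Fin k → Fin n) λ ψ → Injective _≡_ _≡_ ψ × (∀ e → InCopy G ψ e → e ≡ e₀)
  moveSingleEdgeCopy {φ} {e₁} e₀ injective ⊆e₁ = σ ∘ φ , injective ∘ σ-injective , ⊆e₀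
    where
    σ = proj₁ (relabelling e₁ e₀)
    σ-injective = proj₁ (proj₂ (relabelling e₁ e₀))
    σ-ends = proj₂ (proj₂ (relabelling e₁ e₀))
    ⊆e₀ : ∀ e → InCopy G (σ ∘ φ) e → e ≡ e₀
    ⊆e₀ e (d , d∈G , σφd≈e) with imageEdge φ d injective
    ... | e′ , φd≈e′ with ⊆e₁ e′ (d , d∈G , φd≈e′)
    ...   | refl = SameEnds-functional (σ ∘ φ) d σφd≈e
                     (SameEnds-∘ φ d σ {e′} {e₀} (proj₁ σ-ends) (proj₂ σ-ends) φd≈e′)

  singleEdgeCopy-free : ∀ {f : Edge n → Edge n} {φ : Fin k → Fin n} {e₀} →
    f e₀ ≢ e₀ → Injective _≡_ _≡_ φ → (∀ e → InCopy G φ e → e ≡ e₀) → HasFreeCopyKn n G f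
  singleEdgeCopy-free {f} {φ} moved injective ⊆e₀ = φ , (injective , λ _ _ → tt) , free
    where
    free : ∀ e → InCopy G φ e → ¬ InCopy G φ (f e)
    free e e∈φ fe∈φ with ⊆e₀ e e∈φ
    ... | refl = moved (⊆e₀ _ fe∈φ)

  freeCopy⇒freeCopyKn : ∀ {H : Graph n} {fH : E H → E H} {f : Edge n → Edge n} →
    (∀ x → T (H (f (proj₁ x))) → proj₁ (fH x) ≡ f (proj₁ x)) → HasFreeCopy G H fH → HasFreeCopyKn n G f
  freeCopy⇒freeCopyKn {H} {fH} {f} fH≗f (φ , copy@(_ , inH) , free) = φ , isCopy-Kn copy , freeKn
    where
    freeKn : ∀ e → InCopy G φ e → ¬ InCopy G φ (f e)
    freeKn e e∈φ fe∈φ =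
      free (e , inH e e∈φ) e∈φ (subst (InCopy G φ) (sym (fH≗f (e , _) (inH (f e) fe∈φ))) fe∈φ)

  -- Double negation, because whether the copy uses e₁ is not decided.
  pairCopy⇒¬¬freeCopyKn : ∀ {f : Edge n → Edge n} {φ : Fin k → Fin n} {e₀ e₁} →
    f e₀ ≢ e₀ → Injective _≡_ _≡_ φ → (∀ e → InCopy G φ e → e ≡ e₀ ⊎ e ≡ e₁) →
    (InCopy G φ e₀ → ¬ InCopy G φ e₁) → ¬ ¬ HasFreeCopyKn n G f
  pairCopy⇒¬¬freeCopyKn {f} {φ} {e₀} {e₁} moved injective ⊆pair not-both noFreeCopyKn =
    avoids-e₁ contains-e₁
    where
    avoids-e₁ : ¬ ¬ InCopy G φ e₁
    avoids-e₁ e₁∉φ = noFreeCopyKn (singleEdgeCopy-free {f = f} moved injective ⊆e₀)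
      where
      ⊆e₀ : ∀ e → InCopy G φ e → e ≡ e₀
      ⊆e₀ e e∈φ with ⊆pair e e∈φ
      ... | inj₁ e≡e₀ = e≡e₀
      ... | inj₂ refl = ⊥-elim (e₁∉φ e∈φ)
    contains-e₁ : ¬ InCopy G φ e₁
    contains-e₁ e₁∈φ = noFreeCopyKn (singleEdgeCopy-free {f = f} moved ψ-injective ⊆e₀)
      where
      ⊆e₁ : ∀ e → InCopy G φ e → e ≡ e₁
      ⊆e₁ e e∈φ with ⊆pair e e∈φ
      ... | inj₁ refl = ⊥-elim (not-both e∈φ e₁∈φ)
      ... | inj₂ e≡e₁ = e≡e₁
      moved-copy = moveSingleEdgeCopy e₀ injective ⊆e₁
      ψ-injective = proj₁ (proj₂ moved-copy)
      ⊆e₀ = proj₂ (proj₂ moved-copy)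

module _ {n : ℕ} (H : Graph n) (fH : E H → E H) where

  extendByIdentity : Edge n → Edge n
  extendByIdentity e with T? (H e)
  ... | yes e∈H = proj₁ (fH (e , e∈H))
  ... | no _ = e

  extendByIdentity-inside : ∀ {e} (e∈H : T (H e)) → extendByIdentity e ≡ proj₁ (fH (e , e∈H))
  extendByIdentity-inside {e} e∈H with T? (H e)
  ... | yes e∈H′ = cong (λ t → proj₁ (fH (e , t))) (T-irrelevant e∈H′ e∈H)
  ... | no e∉H = ⊥-elim (e∉H e∈H)

  extendByIdentity-outside : ∀ {e} → ¬ T (H e) → extendByIdentity e ≡ e
  extendByIdentity-outside {e} e∉H with T? (H e)
  ... | yes e∈H = ⊥-elim (e∉H e∈H)
  ... | no _ = refl

  freeCopyKn⇒freeCopy : ∀ {k} {G : Graph k} → HasFreeCopyKn n G extendByIdentity → HasFreeCopy G H fH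
  freeCopyKn⇒freeCopy {G = G} (φ , (injective , _) , free) = φ , (injective , inH) , freeH
    where
    inH : ∀ e → InCopy G φ e → T (H e)
    inH e e∈φ with T? (H e)
    ... | yes e∈H = e∈H
    ... | no e∉H = ⊥-elim (free e e∈φ (subst (InCopy G φ) (sym (extendByIdentity-outside e∉H)) e∈φ))
    freeH : ∀ x → InCopy G φ (proj₁ x) → ¬ InCopy G φ (proj₁ (fH x))
    freeH (e , e∈H) e∈φ fe∈φ = free e e∈φ (subst (InCopy G φ) (sym (extendByIdentity-inside e∈H)) fe∈φ)

hPred⇒qPred : ∀ {k} n (G : Graph k) m → HPred n G m → QPred n G m
hPred⇒qPred n G m (H , (L , unique , length≡m , H⇔L) , fH , deranged , noFreeCopy) =
  subst (_≤ n C 2) length≡m (unique⇒length-≤-C2 unique) ,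
  extendByIdentity H fH , (L , unique , length≡m , All.tabulate moved) ,
  noFreeCopy ∘ freeCopyKn⇒freeCopy H fH
  where
  moved : ∀ {e} → e ∈ L → extendByIdentity H fH e ≢ e
  moved {e} e∈L fe≡e = deranged (e , e∈H) (E-≡ (trans (sym (extendByIdentity-inside H fH e∈H)) fe≡e))
    where e∈H = Equivalence.from (H⇔L e) e∈L

graphOf : ∀ {n} → List (Edge n) → Graph n
graphOf L e = isYes (any? (e ≟ₑ_) L)

module _ {n : ℕ} {L : List (Edge n)} where

  T-graphOf : ∀ {e} → T (graphOf L e) ⇔ e ∈ L
  T-graphOf = mk⇔ toWitness fromWitness

  numEdges-graphOf : Unique L → NumEdges (graphOf L) (length L)
  numEdges-graphOf unique = L , unique , refl , λ _ → T-graphOf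

moved? : ∀ {n} (f : Edge n → Edge n) → Decidable (λ e → f e ≢ e)
moved? f e = ¬? (f e ≟ₑ e)

movedEdges : ∀ {n} → (Edge n → Edge n) → List (Edge n)
movedEdges {n} f = filter (moved? f) (allEdges n)

module _ {k n : ℕ} {G : Graph k} {f : Edge n → Edge n} (noFreeCopyKn : ¬ HasFreeCopyKn n G f) where

  hPred-zero : HPred n G 0
  hPred-zero = graphOf [] , numEdges-graphOf [] , empty , (λ { (_ , ()) }) ,
    noFreeCopyKn ∘ freeCopy⇒freeCopyKn {fH = empty} {f = f} (λ { (_ , ()) })
    where
    empty : E (graphOf []) → E (graphOf [])
    empty (_ , ())

  hPred-two : ∀ {e₀ : Edge n} → f e₀ ≢ e₀ → HPred n G 2
  hPred-two {e₀} moved = H , numEdges-graphOf pair-unique , swapPair , swapPair-deranged , noFreeCopy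
    where
    e₁ = f e₀
    pair = e₀ ∷ e₁ ∷ []
    H = graphOf pair
    pair-unique : Unique pair
    pair-unique = ((moved ∘ sym) ∷ All.[]) ∷ (All.[] ∷ [])
    e₀∈H : T (H e₀)
    e₀∈H = fromWitness (here refl)
    e₁∈H : T (H e₁)
    e₁∈H = fromWitness (there (here refl))
    otherOfPair : Edge n → E H
    otherOfPair e with e ≟ₑ e₀
    ... | yes _ = e₁ , e₁∈H
    ... | no _ = e₀ , e₀∈H
    otherOfPair-≢ : ∀ e → proj₁ (otherOfPair e) ≢ e
    otherOfPair-≢ e with e ≟ₑ e₀
    ... | yes refl = moved
    ... | no e≢e₀ = e≢e₀ ∘ sym
    swapPair : E H → E H
    swapPair = otherOfPair ∘ proj₁
    swapPair-deranged : InFH H swapPair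
    swapPair-deranged (e , _) = otherOfPair-≢ e ∘ cong proj₁
    swapPair-e₀ : proj₁ (swapPair (e₀ , e₀∈H)) ≡ e₁
    swapPair-e₀ with e₀ ≟ₑ e₀
    ... | yes _ = refl
    ... | no e₀≢e₀ = ⊥-elim (e₀≢e₀ refl)
    noFreeCopy : ¬ HasFreeCopy G H swapPair
    noFreeCopy (φ , (injective , inH) , free) =
      pairCopy⇒¬¬freeCopyKn {f = f} moved injective ⊆pair not-both noFreeCopyKn
      where
      ⊆pair : ∀ e → InCopy G φ e → e ≡ e₀ ⊎ e ≡ e₁
      ⊆pair e e∈φ with toWitness (inH e e∈φ)
      ... | here e≡e₀ = inj₁ e≡e₀
      ... | there (here e≡e₁) = inj₂ e≡e₁
      not-both : InCopy G φ e₀ → ¬ InCopy G φ e₁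
      not-both e₀∈φ e₁∈φ = free (e₀ , e₀∈H) e₀∈φ (subst (InCopy G φ) (sym swapPair-e₀) e₁∈φ)

  hPred-length : ∀ {a b rest} → Unique (a ∷ b ∷ rest) → All (λ e → f e ≢ e) (a ∷ b ∷ rest) →
    HPred n G (length (a ∷ b ∷ rest))
  hPred-length {a} {b} {rest} unique@((a≢b ∷ _) ∷ _) moved =
    H , numEdges-graphOf unique , redirect , redirect-deranged ,
    noFreeCopyKn ∘ freeCopy⇒freeCopyKn {fH = redirect} redirect≗f
    where
    S = a ∷ b ∷ rest
    H = graphOf S
    other : Edge n → E H
    other e with e ≟ₑ a
    ... | yes _ = b , fromWitness (there (here refl))
    ... | no _ = a , fromWitness (here refl)
    other-≢ : ∀ e → proj₁ (other e) ≢ e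
    other-≢ e with e ≟ₑ a
    ... | yes refl = a≢b ∘ sym
    ... | no e≢a = e≢a ∘ sym
    redirectEdge : Edge n → E H
    redirectEdge e with T? (H (f e))
    ... | yes fe∈H = f e , fe∈H
    ... | no _ = other e
    redirect : E H → E H
    redirect = redirectEdge ∘ proj₁
    redirect≗f : ∀ x → T (H (f (proj₁ x))) → proj₁ (redirect x) ≡ f (proj₁ x)
    redirect≗f (e , _) fe∈H with T? (H (f e))
    ... | yes _ = refl
    ... | no fe∉H = ⊥-elim (fe∉H fe∈H)
    redirectEdge-≢ : ∀ {e} → T (H e) → proj₁ (redirectEdge e) ≢ e
    redirectEdge-≢ {e} e∈H with T? (H (f e))
    ... | yes _ = All.lookup moved (toWitness e∈H)
    ... | no _ = other-≢ e
    redirect-deranged : InFH H redirect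
    redirect-deranged (e , e∈H) = redirectEdge-≢ e∈H ∘ cong proj₁

  hPred-atLeast : (S : List (Edge n)) → Unique S → All (λ e → f e ≢ e) S →
    ∃ λ m → length S ≤ m × HPred n G m
  hPred-atLeast [] _ _ = 0 , z≤n , hPred-zero
  hPred-atLeast (_ ∷ []) _ (moved ∷ _) = 2 , s≤s z≤n , hPred-two moved
  hPred-atLeast S@(_ ∷ _ ∷ _) unique moved = length S , ≤-refl , hPred-length unique moved

qPred⇒hPred-atLeast : ∀ {k} n (G : Graph k) m → QPred n G m → ∃ λ m′ → m ≤ m′ × HPred n G m′
qPred⇒hPred-atLeast n G m (_ , f , (L , unique , refl , movedL) , noFreeCopyKn) =
  let m′ , S≤m′ , hPred = hPred-atLeast noFreeCopyKn S S-unique S-moved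
  in m′ , ≤-trans L≤S S≤m′ , hPred
  where
  S = movedEdges f
  S-unique : Unique S
  S-unique = filter⁺ (moved? f) (allEdges-unique n)
  S-moved : All (λ e → f e ≢ e) S
  S-moved = All.tabulate (proj₂ ∘ ∈-filter⁻ (moved? f) {xs = allEdges n})
  L≤S : length L ≤ length S
  L≤S = unique⇒length-≤ unique (λ e∈L → ∈-filter⁺ (moved? f) (∈-allEdges _) (All.lookup movedL e∈L))

isMax-⇔ : {P Q : ℕ → Set} → (∀ m → Q m → P m) → (∀ m → P m → ∃ λ m′ → m ≤ m′ × Q m′) →
  ∀ x → IsMax P x ⇔ IsMax Q x
isMax-⇔ {P} {Q} Q⇒P P⇒Q≥ x = mk⇔ to from
  where
  to : IsMax P x → IsMax Q x
  to (Px , maxP) with P⇒Q≥ x Px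
  ... | m′ , x≤m′ , Qm′ = subst Q (≤-antisym (maxP m′ (Q⇒P m′ Qm′)) x≤m′) Qm′ , λ m → maxP m ∘ Q⇒P m
  from : IsMax Q x → IsMax P x
  from (Qx , maxQ) = Q⇒P x Qx , λ m Pm → let m′ , m≤m′ , Qm′ = P⇒Q≥ m Pm in ≤-trans m≤m′ (maxQ m′ Qm′)

-- The argument works for every n.
proposition2p4 : (n : ℕ) → 3 ≤ n → {k : ℕ} → (G : Graph k) →
    (x : ℕ) → IsMax (QPred n G) x ⇔ IsMax (HPred n G) x
proposition2p4 n _ G = isMax-⇔ (hPred⇒qPred n G) (qPred⇒hPred-atLeast n G)
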